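{- Let $G$ be an ultrahomogeneous vertex-colored oriented graph with exactly two vertex color classes $R$ and $B$, where $|R|\ge|B|$ and $G[R]\cong E_n$ for some $n\ge1$. If $R$ and $B$ are not homogeneously connected, then $G[B]\cong E_n$ and $R$ and $B$ are matching-connected.
   Context: A vertex-colored oriented graph (finite loopless digraph, never both $(u,v)$ and $(v,u)$ arcs, with a vertex coloring) is identified with the complete colored digraph having edge color $\zeta((u,v))=1$ if $(u,v)$ is an arc and $0$ otherwise. It is ultrahomogeneous if every color-preserving isomorphism between induced subgraphs extends to a color-preserving automorphism. A vertex color class is a maximal set of vertices of one color. $E_n$ is the graph on $n$ vertices with no arcs. Disjoint vertex sets $R,B$ are homogeneously connected if $\zeta$ is constant on $R\times B$ and constant on $B\times R$. They are matching-connected if they are not homogeneously connected and there is a bijection $\alpha:R\to B$ such that $\zeta$ is constant on each of the four sets $\{(r,\alpha(r))\}$, $\{(\alpha(r),r)\}$, $(R\times B)\setminus\{(r,\alpha(r))\}$, $(B\times R)\setminus\{(\alpha(r),r)\}$. -}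

module Defs where

open import Data.Nat using (ℕ; _≤_)
open import Data.Fin using (Fin)
open import Data.Fin.Properties using (_≟_)
open import Data.Bool using (Bool; true; false; not)
open import Data.Bool.Properties renaming (_≟_ to _≟B_)
open import Data.List using (List; length; filter)
open import Data.List using () renaming (allFin to allFinL)
open import Data.Product using (Σ; ∃; ∃-syntax; _×_; _,_)
open import Relation.Binary.PropositionalEquality using (_≡_; _≢_)
open import Relation.Nullary using (¬_)
open import Relation.Unary using (Pred)

-- A vertex-colored oriented graph on vertex set Fin N, colors in Bool.
-- ζ u v = true iff (u,v) is an arc (edge colour 1), false otherwise (edge colour 0).
record ColOrGraph (N : ℕ) : Set where
  field
    col : Fin N → Bool
    ζ   : Fin N → Fin N → Bool
    loopless : ∀ v → ζ v v ≡ false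
    oriented : ∀ u v → ζ u v ≡ true → ζ v u ≡ false
open ColOrGraph public

module _ {N : ℕ} (G : ColOrGraph N) where

  IsAutomorphism : (Fin N → Fin N) → Set
  IsAutomorphism σ =
    (∀ u v → σ u ≡ σ v → u ≡ v) ×
    (∀ w → ∃[ v ] σ v ≡ w) ×
    (∀ v → col G (σ v) ≡ col G v) ×
    (∀ u v → ζ G (σ u) (σ v) ≡ ζ G u v)

  -- A colour-preserving isomorphism between induced subgraphs, presented as
  -- two injective enumerations g, h : Fin k → Fin N; the isomorphism sends g i ↦ h i
  -- (from G[image g] onto G[image h]).
  IsPartialIso : {k : ℕ} → (Fin k → Fin N) → (Fin k → Fin N) → Set
  IsPartialIso {k} g h =
    (∀ i j → g i ≡ g j → i ≡ j) ×
    (∀ i j → h i ≡ h j → i ≡ j) ×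
    (∀ i → col G (h i) ≡ col G (g i)) ×
    (∀ i j → ζ G (h i) (h j) ≡ ζ G (g i) (g j))

  Ultrahomogeneous : Set
  Ultrahomogeneous =
    ∀ (k : ℕ) (g h : Fin k → Fin N) → IsPartialIso g h →
    ∃[ σ ] (IsAutomorphism σ × (∀ i → σ (g i) ≡ h i))

  InClass : Bool → Fin N → Set
  InClass c v = col G v ≡ c

  classSize : Bool → ℕ
  classSize c = length (filter (λ v → col G v ≟B c) (allFinL N))

  -- G[class c] ≅ E_n : an isomorphism from E_n (n vertices, no arcs) onto the
  -- induced subgraph on the colour class c.
  InducedIsoE : Bool → ℕ → Set
  InducedIsoE c n =
    Σ (Fin n → Fin N) λ f →
      (∀ i j → f i ≡ f j → i ≡ j) ×
      (∀ i → InClass c (f i)) ×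
      (∀ v → InClass c v → ∃[ i ] f i ≡ v) ×
      (∀ i j → ζ G (f i) (f j) ≡ false)

  HomConnected : Bool → Bool → Set
  HomConnected c d =
    (∃[ a ] ∀ r b → InClass c r → InClass d b → ζ G r b ≡ a) ×
    (∃[ a ] ∀ r b → InClass c r → InClass d b → ζ G b r ≡ a)

  MatchingConnected : Bool → Bool → Set
  MatchingConnected c d =
    ¬ HomConnected c d ×
    Σ (Fin N → Fin N) λ α →
      (∀ r → InClass c r → InClass d (α r)) ×
      (∀ r r' → InClass c r → InClass c r' → α r ≡ α r' → r ≡ r') ×
      (∀ b → InClass d b → ∃[ r ] (InClass c r × α r ≡ b)) ×
      (∃[ a ] ∀ r → InClass c r → ζ G r (α r) ≡ a) ×
      (∃[ a ] ∀ r → InClass c r → ζ G (α r) r ≡ a) ×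
      (∃[ a ] ∀ r b → InClass c r → InClass d b → b ≢ α r → ζ G r b ≡ a) ×
      (∃[ a ] ∀ r b → InClass c r → InClass d b → b ≢ α r → ζ G b r ≡ a)

{-# OPTIONS --safe #-}
module Submission where

-- Ultrahomogeneity extends every permutation of the independent class R to an automorphism and makes
-- the automorphism group transitive on B. The profile of b ∈ B lists the arc types between b and the
-- vertices of R; permuting R permutes profiles, and distinct profiles belong to distinct vertices of B.
-- The profile is not constant (R and B are not homogeneously connected), and it must take one value T₁
-- at a single vertex and another value T₂ everywhere else: otherwise n suitable transpositions of R
-- would give n + 1 distinct vertices of B, although |B| ≤ |R| = n. Matching r ∈ R with the vertex of B
-- whose exceptional vertex is r is then a bijection commuting with all automorphisms, and
-- transposing two vertices of R shows that B inherits the independence of R.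

open import Defs
open import Data.Bool using (Bool; true; false; not)
open import Data.Bool.Properties using () renaming (_≟_ to _≟B_)
open import Data.Empty using (⊥-elim)
open import Data.Fin using (Fin; zero; suc; fromℕ<)
open import Data.Fin.Properties using (_≟_; injective⇒≤; any?; all?; ¬∀⟶∃¬)
import Data.Fin.Permutation.Components as PC
open import Data.Fin.Permutation using (Permutation′; transpose; _⟨$⟩ʳ_; _⟨$⟩ˡ_; inverseˡ; inverseʳ)
open import Data.List using (List; length; filter; lookup; allFin)
open import Data.List.Membership.Propositional using (_∈_)
open import Data.List.Membership.Propositional.Properties using (∈-filter⁺; ∈-filter⁻; ∈-lookup; ∈-allFin)
open import Data.List.Membership.Setoid.Properties using (index-injective)
open import Data.List.Relation.Unary.All as All using ()
open import Data.List.Relation.Unary.AllPairs using (_∷_)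
open import Data.List.Relation.Unary.Unique.Propositional using (Unique)
open import Data.List.Relation.Unary.Unique.Propositional.Properties using (allFin⁺; filter⁺)
open import Data.Nat using (ℕ; suc; _≤_; _≥_)
open import Data.Nat.Properties using (1+n≰n; module ≤-Reasoning)
open import Data.Product using (Σ-syntax; ∃; ∃-syntax; ∃₂; _×_; _,_; proj₁; proj₂)
open import Data.Product.Properties using (≡-dec)
open import Data.Sum using (_⊎_; inj₁; inj₂)
import Data.Vec.Functional as Vector
open import Function using (_∘_)
open import Level using (Level)
open import Function.Definitions using (Injective)
open import Relation.Binary.Definitions using (DecidableEquality)
open import Relation.Binary.PropositionalEquality
open import Relation.Nullary using (¬_; yes; no)
open import Relation.Nullary.Decidable using (¬?; _×-dec_; dec-true; dec-false; decidable-stable)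
open import Relation.Unary using (Pred; Decidable)

lookup-injective : {A : Set} {xs : List A} → Unique xs →
                   ∀ {i j} → lookup xs i ≡ lookup xs j → i ≡ j
lookup-injective (_ ∷ _)      {zero}  {zero}  _  = refl
lookup-injective (x∉xs ∷ _)   {zero}  {suc j} eq = ⊥-elim (All.lookup x∉xs (∈-lookup j) eq)
lookup-injective (x∉xs ∷ _)   {suc i} {zero}  eq = ⊥-elim (All.lookup x∉xs (∈-lookup i) (sym eq))
lookup-injective (_ ∷ unique) {suc i} {suc j} eq = cong suc (lookup-injective unique eq)

module _ {N : ℕ} {ℓ : Level} {P : Pred (Fin N) ℓ} (P? : Decidable P) where

  injective⇒≤-filter : ∀ {k} (h : Fin k → Fin N) → Injective _≡_ _≡_ h → (∀ i → P (h i)) →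
                       k ≤ length (filter P? (allFin N))
  injective⇒≤-filter h h-injective h∈P =
    injective⇒≤ (λ {i} {j} → h-injective ∘ index-injective (setoid (Fin N)) (member i) (member j))
    where
    member : ∀ i → h i ∈ filter P? (allFin N)
    member i = ∈-filter⁺ P? (∈-allFin (h i)) (h∈P i)

  surjective⇒filter-≤ : ∀ {n} (f : Fin n → Fin N) → (∀ v → P v → ∃[ i ] f i ≡ v) →
                        length (filter P? (allFin N)) ≤ n
  surjective⇒filter-≤ f f-onto = injective⇒≤ {f = proj₁ ∘ preimage} preimage-injective
    where
    L : List (Fin N)
    L = filter P? (allFin N)
    preimage : ∀ j → ∃[ i ] f i ≡ lookup L j
    preimage j = f-onto (lookup L j) (proj₂ (∈-filter⁻ P? {xs = allFin N} (∈-lookup j)))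
    preimage-injective : Injective _≡_ _≡_ (proj₁ ∘ preimage)
    preimage-injective {j} {j′} eq = lookup-injective (filter⁺ P? (allFin⁺ N)) (begin
      lookup L j               ≡⟨ sym (proj₂ (preimage j)) ⟩
      f (proj₁ (preimage j))   ≡⟨ cong f eq ⟩
      f (proj₁ (preimage j′))  ≡⟨ proj₂ (preimage j′) ⟩
      lookup L j′              ∎)
      where open ≡-Reasoning

fresh-∷-injective : ∀ {A : Set} {n} {x : A} {h : Fin n → A} →
                    (∀ i → x ≢ h i) → Injective _≡_ _≡_ h → Injective _≡_ _≡_ (x Vector.∷ h)
fresh-∷-injective x∉h h-injective {zero}  {zero}  _  = refl
fresh-∷-injective x∉h h-injective {zero}  {suc j} eq = ⊥-elim (x∉h j eq)
fresh-∷-injective x∉h h-injective {suc i} {zero}  eq = ⊥-elim (x∉h i (sym eq))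
fresh-∷-injective x∉h h-injective {suc i} {suc j} eq = cong suc (h-injective eq)

transpose-matchˡ : ∀ {n} (i j : Fin n) → PC.transpose i j i ≡ j
transpose-matchˡ i j rewrite dec-true (i ≟ i) refl = refl

transpose-matchʳ : ∀ {n} (i j : Fin n) → PC.transpose i j j ≡ i
transpose-matchʳ i j with j ≟ i
... | yes j≡i = j≡i
... | no _ rewrite dec-true (j ≟ j) refl = refl

transpose-fixes : ∀ {n} {i j k : Fin n} → k ≢ i → k ≢ j → PC.transpose i j k ≡ k
transpose-fixes {i = i} {j} {k} k≢i k≢j rewrite dec-false (k ≟ i) k≢i | dec-false (k ≟ j) k≢j = refl

module _ {A : Set} (_≟A_ : DecidableEquality A) {n : ℕ} (q : Fin n → A) where

  SingleOutlier : Set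
  SingleOutlier = Σ[ x ∈ Fin n ] Σ[ t ∈ A ] q x ≢ t × (∀ y → y ≢ x → q y ≡ t)

  -- Each transposition (i π i) changes the value at i, and since π has no 2-cycles, distinct i
  -- give distinct transpositions.
  SwapPartners : (Fin n → Fin n) → Set
  SwapPartners π = ∀ i → q (π i) ≢ q i × π (π i) ≢ i

  outlier-or-witness : (x : Fin n) (t : A) → (∀ y → y ≢ x → q y ≡ t) ⊎ ∃[ y ] y ≢ x × q y ≢ t
  outlier-or-witness x t with any? (λ y → ¬? (y ≟ x) ×-dec ¬? (q y ≟A t))
  ... | yes witness = inj₂ witness
  ... | no none     = inj₁ λ y y≢x → decidable-stable (q y ≟A t) (λ qy≢t → none (y , y≢x , qy≢t))

  swapPartners-from-three-values : ∀ {a c w} → q a ≢ q c → q w ≢ q a → q w ≢ q c → ∃ SwapPartners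
  swapPartners-from-three-values {a} {c} {w} qa≢qc qw≢qa qw≢qc = π , partners
    where
    π : Fin n → Fin n
    π r with q r ≟A q a | q r ≟A q c
    ... | yes _ | _     = c
    ... | no _  | yes _ = w
    ... | no _  | no _  = a

    π-a : π a ≡ c
    π-a with q a ≟A q a
    ... | yes _    = refl
    ... | no qa≢qa = ⊥-elim (qa≢qa refl)

    π-c : π c ≡ w
    π-c with q c ≟A q a | q c ≟A q c
    ... | yes qc≡qa | _        = ⊥-elim (qa≢qc (sym qc≡qa))
    ... | no _      | yes _    = refl
    ... | no _      | no qc≢qc = ⊥-elim (qc≢qc refl)

    π-w : π w ≡ a
    π-w with q w ≟A q a | q w ≟A q c
    ... | yes qw≡qa | _         = ⊥-elim (qw≢qa qw≡qa)
    ... | no _      | yes qw≡qc = ⊥-elim (qw≢qc qw≡qc)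
    ... | no _      | no _      = refl

    partners : ∀ r → q (π r) ≢ q r × π (π r) ≢ r
    partners r with q r ≟A q a | q r ≟A q c
    ... | yes r∼a | _
      rewrite π-c
      = (λ qc≡qr → qa≢qc (trans (sym r∼a) (sym qc≡qr)))
      , (λ w≡r → qw≢qa (trans (cong q w≡r) r∼a))
    ... | no _ | yes r∼c
      rewrite π-w
      = (λ qw≡qr → qw≢qc (trans qw≡qr r∼c))
      , (λ a≡r → qa≢qc (trans (cong q a≡r) r∼c))
    ... | no r≁a | no r≁c
      rewrite π-a
      = (λ qa≡qr → r≁a (sym qa≡qr))
      , (λ c≡r → r≁c (cong q (sym c≡r)))

  swapPartners-from-two-pairs : ∀ {a c y z} → q a ≢ q c → y ≢ a → q y ≡ q a → z ≢ c → q z ≡ q c →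
                                ∃ SwapPartners
  swapPartners-from-two-pairs {a} {c} {y} {z} qa≢qc y≢a y∼a z≢c z∼c = π , partners
    where
    π : Fin n → Fin n
    π r with q r ≟A q a | r ≟ a | r ≟ z
    ... | yes _ | yes _ | _     = z
    ... | yes _ | no _  | _     = c
    ... | no _  | _     | yes _ = y
    ... | no _  | _     | no _  = a

    qz≢qa : q z ≢ q a
    qz≢qa qz≡qa = qa≢qc (trans (sym qz≡qa) z∼c)

    π-a : π a ≡ z
    π-a with q a ≟A q a | a ≟ a
    ... | yes _    | yes _   = refl
    ... | yes _    | no a≢a  = ⊥-elim (a≢a refl)
    ... | no qa≢qa | _       = ⊥-elim (qa≢qa refl)

    π-y : π y ≡ c
    π-y with q y ≟A q a | y ≟ a
    ... | yes _    | yes y≡a = ⊥-elim (y≢a y≡a)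
    ... | yes _    | no _    = refl
    ... | no qy≢qa | _       = ⊥-elim (qy≢qa y∼a)

    π-z : π z ≡ y
    π-z with q z ≟A q a | z ≟ z
    ... | yes qz≡qa | _        = ⊥-elim (qz≢qa qz≡qa)
    ... | no _      | yes _    = refl
    ... | no _      | no z≢z   = ⊥-elim (z≢z refl)

    π-c : π c ≡ a
    π-c with q c ≟A q a | c ≟ z
    ... | yes qc≡qa | _       = ⊥-elim (qa≢qc (sym qc≡qa))
    ... | no _      | yes c≡z = ⊥-elim (z≢c (sym c≡z))
    ... | no _      | no _    = refl

    partners : ∀ r → q (π r) ≢ q r × π (π r) ≢ r
    partners r with q r ≟A q a | r ≟ a | r ≟ z
    ... | yes _ | yes refl | _
      rewrite π-z
      = qz≢qa , y≢a
    ... | yes r∼a | no r≢a | _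
      rewrite π-c
      = (λ qc≡qr → qa≢qc (trans (sym r∼a) (sym qc≡qr))) , (λ a≡r → r≢a (sym a≡r))
    ... | no r≁a | _ | yes refl
      rewrite π-y
      = (λ qy≡qz → r≁a (trans (sym qy≡qz) y∼a)) , (λ c≡z → z≢c (sym c≡z))
    ... | no r≁a | _ | no r≢z
      rewrite π-a
      = (λ qa≡qr → r≁a (sym qa≡qr)) , (λ z≡r → r≢z (sym z≡r))

  singleOutlier⊎swapPartners : ∀ {a c} → q a ≢ q c → SingleOutlier ⊎ ∃ SwapPartners
  singleOutlier⊎swapPartners {a} {c} qa≢qc
    with outlier-or-witness a (q c) | outlier-or-witness c (q a)
  ... | inj₁ a-outlier | _ = inj₁ (a , q c , qa≢qc , a-outlier)
  ... | inj₂ _ | inj₁ c-outlier = inj₁ (c , q a , qa≢qc ∘ sym , c-outlier)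
  ... | inj₂ (y , y≢a , qy≢qc) | inj₂ (z , z≢c , qz≢qa) with q y ≟A q a | q z ≟A q c
  ...   | no qy≢qa | _        = inj₂ (swapPartners-from-three-values qa≢qc qy≢qa qy≢qc)
  ...   | yes _    | no qz≢qc = inj₂ (swapPartners-from-three-values qa≢qc qz≢qa qz≢qc)
  ...   | yes y∼a  | yes z∼c  = inj₂ (swapPartners-from-two-pairs qa≢qc y≢a y∼a z≢c z∼c)

module _ {N : ℕ} (G : ColOrGraph N) where

  Link : Set
  Link = Bool × Bool

  _≟ₗ_ : DecidableEquality Link
  _≟ₗ_ = ≡-dec _≟B_ _≟B_

  link : Fin N → Fin N → Link
  link x y = ζ G x y , ζ G y x

  automorphism-preserves-link : ∀ {σ} → IsAutomorphism G σ → ∀ x y → link (σ x) (σ y) ≡ link x y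
  automorphism-preserves-link (_ , _ , _ , ζ-preserved) x y = cong₂ _,_ (ζ-preserved x y) (ζ-preserved y x)

  symmetric⇒no-arc : ∀ {x y} → ζ G x y ≡ ζ G y x → ζ G x y ≡ false
  symmetric⇒no-arc {x} {y} xy≡yx with ζ G x y in arc
  ... | false = refl
  ... | true  = trans xy≡yx (oriented G x y arc)

  ultrahomogeneous⇒colour-transitive : Ultrahomogeneous G →
    ∀ {u v} → col G u ≡ col G v → ∃[ σ ] IsAutomorphism G σ × σ u ≡ v
  ultrahomogeneous⇒colour-transitive UH {u} {v} same-colour
    with UH 1 (λ _ → u) (λ _ → v)
           ( (λ { zero zero _ → refl })
           , (λ { zero zero _ → refl })
           , (λ _ → sym same-colour)
           , (λ _ _ → trans (loopless G v) (sym (loopless G u))))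
  ... | σ , aut , σu≡v = σ , aut , σu≡v zero

  module IndependentClass (UH : Ultrahomogeneous G) {c : Bool} {n : ℕ} (R : InducedIsoE G c n) where

    f : Fin n → Fin N
    f = proj₁ R

    f-injective : ∀ i j → f i ≡ f j → i ≡ j
    f-injective = proj₁ (proj₂ R)

    f∈R : ∀ i → InClass G c (f i)
    f∈R = proj₁ (proj₂ (proj₂ R))

    f-onto : ∀ v → InClass G c v → ∃[ i ] f i ≡ v
    f-onto = proj₁ (proj₂ (proj₂ (proj₂ R)))

    f-independent : ∀ i j → ζ G (f i) (f j) ≡ false
    f-independent = proj₂ (proj₂ (proj₂ (proj₂ R)))

    permutation-extends : (ρ : Permutation′ n) →
                          ∃[ σ ] IsAutomorphism G σ × (∀ j → σ (f j) ≡ f (ρ ⟨$⟩ʳ j))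
    permutation-extends ρ = UH n f (f ∘ (ρ ⟨$⟩ʳ_))
      ( f-injective
      , (λ i j ρfi≡ρfj → ρ-injective (f-injective _ _ ρfi≡ρfj))
      , (λ i → trans (f∈R _) (sym (f∈R i)))
      , (λ i j → trans (f-independent _ _) (sym (f-independent i j))))
      where
      ρ-injective : Injective _≡_ _≡_ (ρ ⟨$⟩ʳ_)
      ρ-injective eq = trans (sym (inverseˡ ρ)) (trans (cong (ρ ⟨$⟩ˡ_) eq) (inverseˡ ρ))

    automorphism-onto-class : ∀ {σ} → IsAutomorphism G σ → ∀ {y} → InClass G c y → ∃[ j ] σ (f j) ≡ y
    automorphism-onto-class {σ} (_ , onto , col-preserved , _) {y} y∈R
      with onto y
    ... | x , σx≡y with f-onto x (trans (sym (col-preserved x)) (trans (cong (col G) σx≡y) y∈R))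
    ...   | j , fj≡x = j , trans (cong σ fj≡x) σx≡y

    profile : Fin N → Fin n → Link
    profile b j = link (f j) b

    profile-permuted : ∀ {σ} → IsAutomorphism G σ →
                       (ρ : Permutation′ n) → (∀ j → σ (f j) ≡ f (ρ ⟨$⟩ʳ j)) →
                       ∀ b j → profile (σ b) j ≡ profile b (ρ ⟨$⟩ˡ j)
    profile-permuted {σ} aut ρ σ-extends b j = begin
      link (f j) (σ b)               ≡⟨ cong (λ x → link x (σ b)) (sym σ-hits-fj) ⟩
      link (σ (f (ρ ⟨$⟩ˡ j))) (σ b)  ≡⟨ automorphism-preserves-link aut _ _ ⟩
      link (f (ρ ⟨$⟩ˡ j)) b          ∎
      where
      open ≡-Reasoning
      σ-hits-fj : σ (f (ρ ⟨$⟩ˡ j)) ≡ f j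
      σ-hits-fj = trans (σ-extends _) (cong f (inverseʳ ρ))

    profile-covers-links : ∀ {r b b′} → InClass G c r → col G b ≡ col G b′ →
                           ∃[ j ] link r b ≡ profile b′ j
    profile-covers-links r∈R same-colour
      with ultrahomogeneous⇒colour-transitive UH (sym same-colour)
    ... | σ , aut , refl with automorphism-onto-class aut r∈R
    ...   | j , refl = j , automorphism-preserves-link aut (f j) _

    constant-profile⇒homConnected : ∀ {b₀ t} → InClass G (not c) b₀ → (∀ j → profile b₀ j ≡ t) →
                                    HomConnected G c (not c)
    constant-profile⇒homConnected {t = t} b₀∈B constant =
        (proj₁ t , λ r b r∈R b∈B → cong proj₁ (link≡t r∈R b∈B))
      , (proj₂ t , λ r b r∈R b∈B → cong proj₂ (link≡t r∈R b∈B))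
      where
      link≡t : ∀ {r b} → InClass G c r → InClass G (not c) b → link r b ≡ t
      link≡t r∈R b∈B with profile-covers-links r∈R (trans b∈B (sym b₀∈B))
      ... | j , link≡profile = trans link≡profile (constant j)

    module _ (size : classSize G c ≥ classSize G (not c)) where

      injection-onto-opposite : (h : Fin n → Fin N) → Injective _≡_ _≡_ h →
                                (∀ i → InClass G (not c) (h i)) →
                                ∀ {b} → InClass G (not c) b → ∃[ i ] h i ≡ b
      injection-onto-opposite h h-injective h∈B {b} b∈B with any? (λ i → h i ≟ b)
      ... | yes found  = found
      ... | no missing = ⊥-elim (1+n≰n (begin
            suc n                ≤⟨ injective⇒≤-filter (λ v → col G v ≟B not c) (b Vector.∷ h)
                                      (fresh-∷-injective (λ i b≡hi → missing (i , sym b≡hi)) h-injective)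
                                      (λ { zero → b∈B ; (suc i) → h∈B i }) ⟩
            classSize G (not c)  ≤⟨ size ⟩
            classSize G c        ≤⟨ surjective⇒filter-≤ (λ v → col G v ≟B c) f f-onto ⟩
            n                    ∎))
        where open ≤-Reasoning

      -- Transposing i with π i moves b to a vertex whose profile differs from b's at i. These
      -- n vertices are pairwise distinct, so by counting one of them is b itself.
      no-swap-partners : ∀ {b} → InClass G (not c) b → ∀ π → ¬ SwapPartners _≟ₗ_ (profile b) π
      no-swap-partners {b} b∈B π partners =
        let i , moved-i≡b = injection-onto-opposite moved moved-injective moved∈B b∈B
        in moved-changes-own i (cong (λ v → profile v i) moved-i≡b)
        where
        swap : ∀ i → ∃[ σ ] IsAutomorphism G σ × (∀ j → σ (f j) ≡ f (transpose i (π i) ⟨$⟩ʳ j))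
        swap i = permutation-extends (transpose i (π i))

        moved : Fin n → Fin N
        moved i = proj₁ (swap i) b

        moved∈B : ∀ i → InClass G (not c) (moved i)
        moved∈B i with swap i
        ... | _ , (_ , _ , col-preserved , _) , _ = trans (col-preserved b) b∈B

        moved-profile : ∀ i j → profile (moved i) j ≡ profile b (PC.transpose (π i) i j)
        moved-profile i j with swap i
        ... | _ , aut , extends = profile-permuted aut (transpose i (π i)) extends b j

        moved-changes-own : ∀ i → profile (moved i) i ≢ profile b i
        moved-changes-own i same = proj₁ (partners i)
          (trans (cong (profile b) (sym (transpose-matchʳ (π i) i))) (trans (sym (moved-profile i i)) same))

        partner-forced : ∀ {i i′} → i ≢ i′ → moved i ≡ moved i′ → i ≡ π i′
        partner-forced {i} {i′} i≢i′ same with i ≟ π i′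
        ... | yes i≡πi′ = i≡πi′
        ... | no i≢πi′  = ⊥-elim (moved-changes-own i (begin
              profile (moved i) i                   ≡⟨ cong (λ v → profile v i) same ⟩
              profile (moved i′) i                  ≡⟨ moved-profile i′ i ⟩
              profile b (PC.transpose (π i′) i′ i)  ≡⟨ cong (profile b) (transpose-fixes i≢πi′ i≢i′) ⟩
              profile b i                           ∎))
          where open ≡-Reasoning

        moved-injective : Injective _≡_ _≡_ moved
        moved-injective {i} {i′} same with i ≟ i′
        ... | yes i≡i′ = i≡i′
        ... | no i≢i′  = ⊥-elim (proj₂ (partners i) (begin
              π (π i)  ≡⟨ cong π (sym (partner-forced (i≢i′ ∘ sym) (sym same))) ⟩
              π i′     ≡⟨ sym (partner-forced i≢i′ same) ⟩
              i        ∎))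
          where open ≡-Reasoning

      module Matching {b₀ : Fin N} (b₀∈B : InClass G (not c) b₀) (not-homogeneous : ¬ HomConnected G c (not c))
                      (i₀ : Fin n) where

        profile-nonconstant : ∃₂ λ a a′ → profile b₀ a ≢ profile b₀ a′
        profile-nonconstant with all? (λ j → profile b₀ j ≟ₗ profile b₀ i₀)
        ... | yes constant   = ⊥-elim (not-homogeneous (constant-profile⇒homConnected b₀∈B constant))
        ... | no nonconstant =
          let a , a≁i₀ = ¬∀⟶∃¬ n _ (λ j → profile b₀ j ≟ₗ profile b₀ i₀) nonconstant
          in a , i₀ , a≁i₀

        outlier : SingleOutlier _≟ₗ_ (profile b₀)
        outlier with singleOutlier⊎swapPartners _≟ₗ_ (profile b₀) (proj₂ (proj₂ profile-nonconstant))
        ... | inj₁ single-outlier = single-outlier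
        ... | inj₂ (π , partners) = ⊥-elim (no-swap-partners b₀∈B π partners)

        x₀ : Fin n
        x₀ = proj₁ outlier

        T₁ T₂ : Link
        T₁ = profile b₀ x₀
        T₂ = proj₁ (proj₂ outlier)

        T₁≢T₂ : T₁ ≢ T₂
        T₁≢T₂ = proj₁ (proj₂ (proj₂ outlier))

        profile-off-x₀ : ∀ j → j ≢ x₀ → profile b₀ j ≡ T₂
        profile-off-x₀ = proj₂ (proj₂ (proj₂ outlier))

        carrier : ∀ {r} → InClass G c r → ∃[ σ ] IsAutomorphism G σ × σ (f x₀) ≡ r
        carrier r∈R = ultrahomogeneous⇒colour-transitive UH (trans (f∈R x₀) (sym r∈R))

        α : Fin N → Fin N
        α v with col G v ≟B c
        ... | yes v∈R = proj₁ (carrier v∈R) b₀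
        ... | no _    = v

        α-carrier : ∀ {r} → InClass G c r → ∃[ σ ] IsAutomorphism G σ × σ (f x₀) ≡ r × σ b₀ ≡ α r
        α-carrier {r} r∈R with col G r ≟B c
        ... | yes r∈R′ = let σ , aut , σfx₀≡r = carrier r∈R′ in σ , aut , σfx₀≡r , refl
        ... | no r∉R   = ⊥-elim (r∉R r∈R)

        α∈B : ∀ {r} → InClass G c r → InClass G (not c) (α r)
        α∈B r∈R with α-carrier r∈R
        ... | _ , (_ , _ , col-preserved , _) , _ , σb₀≡αr =
          trans (cong (col G) (sym σb₀≡αr)) (trans (col-preserved b₀) b₀∈B)

        link-α-self : ∀ {r} → InClass G c r → link r (α r) ≡ T₁
        link-α-self r∈R with α-carrier r∈R
        ... | _ , aut , refl , σb₀≡αr =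
          trans (cong (link _) (sym σb₀≡αr)) (automorphism-preserves-link aut (f x₀) b₀)

        link-α-other : ∀ {r y} → InClass G c r → InClass G c y → y ≢ r → link y (α r) ≡ T₂
        link-α-other r∈R y∈R y≢r with α-carrier r∈R
        ... | σ , aut , refl , σb₀≡αr with automorphism-onto-class aut y∈R
        ...   | j , refl = begin
          link (σ (f j)) (α (σ (f x₀)))  ≡⟨ cong (link (σ (f j))) (sym σb₀≡αr) ⟩
          link (σ (f j)) (σ b₀)          ≡⟨ automorphism-preserves-link aut (f j) b₀ ⟩
          profile b₀ j                   ≡⟨ profile-off-x₀ j (λ j≡x₀ → y≢r (cong (σ ∘ f) j≡x₀)) ⟩
          T₂                             ∎
          where open ≡-Reasoning

        link-α≡T₁⇒≡ : ∀ {r y} → InClass G c r → InClass G c y → link y (α r) ≡ T₁ → y ≡ r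
        link-α≡T₁⇒≡ {r} {y} r∈R y∈R link≡T₁ with y ≟ r
        ... | yes y≡r = y≡r
        ... | no y≢r  = ⊥-elim (T₁≢T₂ (trans (sym link≡T₁) (link-α-other r∈R y∈R y≢r)))

        α-injective : ∀ r r′ → InClass G c r → InClass G c r′ → α r ≡ α r′ → r ≡ r′
        α-injective r r′ r∈R r′∈R αr≡αr′ =
          link-α≡T₁⇒≡ r′∈R r∈R (trans (cong (link r) (sym αr≡αr′)) (link-α-self r∈R))

        α-onto : ∀ b → InClass G (not c) b → ∃[ r ] (InClass G c r × α r ≡ b)
        α-onto b b∈B =
          let i , αfi≡b = injection-onto-opposite (α ∘ f)
                            (λ {i} {j} → f-injective i j ∘ α-injective (f i) (f j) (f∈R i) (f∈R j))
                            (α∈B ∘ f∈R) b∈B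
          in f i , f∈R i , αfi≡b

        link-off-matching : ∀ r b → InClass G c r → InClass G (not c) b → b ≢ α r → link r b ≡ T₂
        link-off-matching r b r∈R b∈B b≢αr with α-onto b b∈B
        ... | r′ , r′∈R , refl = link-α-other r′∈R r∈R (λ r≡r′ → b≢αr (cong α (sym r≡r′)))

        α-equivariant : ∀ {σ r} → IsAutomorphism G σ → InClass G c r → σ (α r) ≡ α (σ r)
        α-equivariant {σ} {r} aut@(_ , _ , col-preserved , _) r∈R
          with α-onto (σ (α r)) (trans (col-preserved (α r)) (α∈B r∈R))
        ... | r′ , r′∈R , αr′≡σαr = trans (sym αr′≡σαr) (cong α (sym σr≡r′))
          where
          σr≡r′ : σ r ≡ r′
          σr≡r′ = link-α≡T₁⇒≡ r′∈R (trans (col-preserved r) r∈R) (begin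
            link (σ r) (α r′)      ≡⟨ cong (link (σ r)) αr′≡σαr ⟩
            link (σ r) (σ (α r))   ≡⟨ automorphism-preserves-link aut r (α r) ⟩
            link r (α r)           ≡⟨ link-α-self r∈R ⟩
            T₁                     ∎)
            where open ≡-Reasoning

        -- The automorphism transposing f i and f j swaps their partners, so the arcs between the
        -- partners are symmetric, hence absent.
        α-independent : ∀ i j → ζ G (α (f i)) (α (f j)) ≡ false
        α-independent i j with permutation-extends (transpose i j)
        ... | σ , aut@(_ , _ , _ , ζ-preserved) , extends = symmetric⇒no-arc (begin
          ζ G (α (f i)) (α (f j))          ≡⟨ sym (ζ-preserved _ _) ⟩
          ζ G (σ (α (f i))) (σ (α (f j)))  ≡⟨ cong₂ (ζ G) (α-equivariant aut (f∈R i))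
                                                              (α-equivariant aut (f∈R j)) ⟩
          ζ G (α (σ (f i))) (α (σ (f j)))  ≡⟨ cong₂ (λ x y → ζ G (α x) (α y)) σfi≡fj σfj≡fi ⟩
          ζ G (α (f j)) (α (f i))          ∎)
          where
          open ≡-Reasoning
          σfi≡fj : σ (f i) ≡ f j
          σfi≡fj = trans (extends i) (cong f (transpose-matchˡ i j))
          σfj≡fi : σ (f j) ≡ f i
          σfj≡fi = trans (extends j) (cong f (transpose-matchʳ i j))

        opposite-independent : InducedIsoE G (not c) n
        opposite-independent =
            α ∘ f
          , (λ i j → f-injective i j ∘ α-injective (f i) (f j) (f∈R i) (f∈R j))
          , α∈B ∘ f∈R
          , (λ b b∈B → let r , r∈R , αr≡b = α-onto b b∈B
                           i , fi≡r = f-onto r r∈R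
                       in i , trans (cong α fi≡r) αr≡b)
          , α-independent

        matching-connected : MatchingConnected G c (not c)
        matching-connected =
            not-homogeneous
          , α
          , (λ _ → α∈B)
          , α-injective
          , α-onto
          , (proj₁ T₁ , λ r r∈R → cong proj₁ (link-α-self r∈R))
          , (proj₂ T₁ , λ r r∈R → cong proj₂ (link-α-self r∈R))
          , (proj₁ T₂ , λ r b r∈R b∈B b≢αr → cong proj₁ (link-off-matching r b r∈R b∈B b≢αr))
          , (proj₂ T₂ , λ r b r∈R b∈B b≢αr → cong proj₂ (link-off-matching r b r∈R b∈B b≢αr))

mainTheorem12 : ∀ {N : ℕ} (G : ColOrGraph N) → Ultrahomogeneous G →
    (∀ (c : Bool) → ∃[ v ] col G v ≡ c) →
    ∀ (r : Bool) (n : ℕ) → 1 ≤ n →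
    classSize G r ≥ classSize G (not r) →
    InducedIsoE G r n →
    ¬ HomConnected G r (not r) →
    InducedIsoE G (not r) n × MatchingConnected G r (not r)
mainTheorem12 G UH inhabited r n 1≤n size R not-homogeneous =
  opposite-independent , matching-connected
  where
  open IndependentClass G UH R
  open Matching size (proj₂ (inhabited (not r))) not-homogeneous (fromℕ< 1≤n)
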